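{- Let $n,m\in \mathbb{Z}^+$ with $n,m\geq 2$, and let $P_m$ be the path on $m$ vertices. Then \[ \chi_n(P_m)= \begin{cases} 2, & \text{if } n\geq 3 \text{ or } (n = 2 \text{ and } m\leq 3), \\ 3, & \text{if } n = 2 \text{ and } m \geq 4. \end{cases}\]
   Context: For a graph $G=(V,E)$, a $\mathbb{Z}$-labeling is a map $\ell:V\to\mathbb{Z}$; its order is the size of its range; it is proper if adjacent vertices get different labels. $N[v]$ is the closed neighborhood of $v$. A closed coloring with nonzero remainders mod $n$ is a labeling with $\sum_{w\in N[v]}\ell(w)\not\equiv 0 \pmod n$ for all $v\in V$. $\chi_n(G)$ denotes the minimum order of a proper closed coloring with nonzero remainders mod $n$ of $G$. -}

module Defs where

open import Data.Nat as ℕ using (ℕ; suc)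
open import Data.Integer as ℤ using (ℤ; +_)
open import Data.Integer.Divisibility using (_∣_)
open import Data.Fin using (Fin; toℕ)
open import Data.List using (List; length; map; allFin; deduplicate; filter; foldr)
open import Data.Sum using (_⊎_; inj₁; inj₂)
import Data.Sum as Sum
open import Relation.Nullary.Decidable using (_⊎-dec_)
import Data.Fin.Properties as FinP
open import Data.Nat.Properties using (1+n≢n)
open import Data.Product using (Σ; _×_)
open import Relation.Binary.PropositionalEquality using (_≡_; refl)
open import Relation.Nullary using (¬_; Dec)
import Relation.Nullary.Decidable as D
open import Relation.Binary using (Rel; Decidable; Symmetric; Irreflexive)
open import Level using (0ℓ)

record Graph : Set₁ where
  field
    k     : ℕ
    Adj   : Rel (Fin k) 0ℓ
    adj?  : Decidable Adj
    sym   : Symmetric Adj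
    irrefl : Irreflexive _≡_ Adj

open Graph public

PathAdj : (m : ℕ) → Rel (Fin m) 0ℓ
PathAdj m i j = (suc (toℕ i) ≡ toℕ j) ⊎ (suc (toℕ j) ≡ toℕ i)


PathGraph : ℕ → Graph
PathGraph m = record
  { k = m
  ; Adj = PathAdj m
  ; adj? = λ i j → (suc (toℕ i) ℕ.≟ toℕ j) ⊎-dec (suc (toℕ j) ℕ.≟ toℕ i)
  ; sym = Sum.swap
  ; irrefl = irr
  }
  where
  irr : ∀ {i j} → i ≡ j → ¬ PathAdj m i j
  irr refl (inj₁ e) = 1+n≢n e
  irr refl (inj₂ e) = 1+n≢n e

Labeling : Graph → Set
Labeling G = Fin (k G) → ℤ

order : (G : Graph) → Labeling G → ℕ
order G ℓ = length (deduplicate ℤ._≟_ (map ℓ (allFin (k G))))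

Proper : (G : Graph) → Labeling G → Set
Proper G ℓ = ∀ v w → Adj G v w → ¬ (ℓ v ≡ ℓ w)

closedNbhd : (G : Graph) → Fin (k G) → List (Fin (k G))
closedNbhd G v = filter (λ w → (v FinP.≟ w) ⊎-dec adj? G v w) (allFin (k G))

closedSum : (G : Graph) → Labeling G → Fin (k G) → ℤ
closedSum G ℓ v = foldr ℤ._+_ (+ 0) (map ℓ (closedNbhd G v))

ClosedColoringMod : ℕ → (G : Graph) → Labeling G → Set
ClosedColoringMod n G ℓ = ∀ v → ¬ ((+ n) ∣ closedSum G ℓ v)

ProperClosedColoringMod : ℕ → (G : Graph) → Labeling G → Set
ProperClosedColoringMod n G ℓ = Proper G ℓ × ClosedColoringMod n G ℓ

ChiIs : ℕ → Graph → ℕ → Set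
ChiIs n G c =
  Σ (Labeling G) (λ ℓ → ProperClosedColoringMod n G ℓ × order G ℓ ≡ c)
  × (∀ (ℓ : Labeling G) → ProperClosedColoringMod n G ℓ → c ℕ.≤ order G ℓ)

-- A proper labeling of a path needs two labels, and 0,1,0,1,… has closed sums 1 (at the ends) and
-- 1 or 2 (inside), which no n ≥ 3 divides; for n = 2 and m ≤ 3 all its closed sums are 1.
-- For n = 2 and m ≥ 4 a proper labeling with only two labels on the first four vertices reads
-- a,b,a,b, and its closed sums at the first three vertices add up to 4(a + b), so one is even.
-- Three labels do suffice: 0,1,2,0,1,2,… has interior sums 3, and its end sums are odd unless an
-- end pair is (2,0); starting the pattern at 1 when m ≡ 1 (mod 3) avoids that at both ends.
module Submission where

open import Defs
open import Data.Nat using (ℕ; _≤_; _≥_)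
open import Relation.Binary.PropositionalEquality using (_≡_)
open import Data.Sum using (_⊎_)
open import Data.Product using (_×_)

open import Data.Bool using (true; false)
open import Data.Empty using (⊥; ⊥-elim)
open import Data.Fin using (Fin; zero; suc; toℕ; fromℕ; inject₁)
open import Data.Fin.Properties using (toℕ-inject₁; toℕ-fromℕ)
import Data.Fin.Properties as Fin using (_≟_)
open import Data.Integer as ℤ using (ℤ; +_; _+_; _*_)
open import Data.Integer.Divisibility using (_∣_)
import Data.Integer.Divisibility.Signed as Signed
open import Data.Integer.DivMod using (_/ℕ_; _%ℕ_; a≡a%ℕn+[a/ℕn]*n; n%ℕd<d)
import Data.Integer.Properties as ℤ using (+-identityˡ; +-identityʳ)
open import Data.Integer.Tactic.RingSolver using (solve-∀)
open import Data.List using (List; []; _∷_; _++_; foldr; map; filter; allFin; length; deduplicate)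
open import Data.List.Membership.Propositional using (_∈_)
open import Data.List.Membership.Propositional.Properties
  using (∈-∃++; ∈-++⁻; ∈-++⁺ˡ; ∈-++⁺ʳ; ∈-map⁺; ∈-map⁻; ∈-allFin; ∈-deduplicate⁺; ∈-deduplicate⁻)
open import Data.List.Properties using (map-tabulate; filter-none; length-++-sucʳ)
open import Data.List.Relation.Binary.Subset.Propositional using (_⊆_)
open import Data.List.Relation.Unary.All as All using ([]; _∷_)
open import Data.List.Relation.Unary.All.Properties using (tabulate⁺)
open import Data.List.Relation.Unary.AllPairs using ([]; _∷_)
open import Data.List.Relation.Unary.Any using (here; there)
open import Data.List.Relation.Unary.Unique.Propositional using (Unique)
open import Data.List.Relation.Unary.Unique.DecPropositional.Properties ℤ._≟_ using (deduplicate-!)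
open import Data.Nat as ℕ using (zero; suc; z≤n; s≤s)
import Data.Nat.Divisibility as ℕ using (_∣?_; >⇒∤)
open import Data.Nat.Properties using (≤-antisym; ≤-trans)
open import Data.Product using (_,_)
open import Data.Sum using (inj₁; inj₂)
open import Function using (_∘_)
open import Level using (Level)
open import Relation.Binary.PropositionalEquality as ≡ using (_≢_; refl; trans; cong; cong₂; subst)
open import Relation.Nullary using (¬_; does; yes; no)
open import Relation.Nullary.Decidable using (from-no; _⊎-dec_)
open import Relation.Unary using (Pred; Decidable)

private variable
  a b p q : Level

filter-map : ∀ {A : Set a} {B : Set b} {P : Pred B p} {Q : Pred A q}
             (P? : Decidable P) (Q? : Decidable Q) (f : A → B) →
             (∀ x → does (P? (f x)) ≡ does (Q? x)) →
             ∀ xs → filter P? (map f xs) ≡ map f (filter Q? xs)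
filter-map P? Q? f same [] = refl
filter-map P? Q? f same (x ∷ xs) rewrite same x with does (Q? x)
... | true  = cong (f x ∷_) (filter-map P? Q? f same xs)
... | false = filter-map P? Q? f same xs

unique-⊆⇒length-≤ : ∀ {A : Set a} {xs ys : List A} → Unique xs → xs ⊆ ys → length xs ≤ length ys
unique-⊆⇒length-≤ {xs = []} _ _ = z≤n
unique-⊆⇒length-≤ {xs = x ∷ xs} (x∉xs ∷ unique) xs⊆ys with ∈-∃++ (xs⊆ys (here refl))
... | ys₁ , ys₂ , refl =
  subst (suc (length xs) ≤_) (≡.sym (length-++-sucʳ ys₁ x ys₂)) (s≤s (unique-⊆⇒length-≤ unique xs⊆ys₁++ys₂))
  where
  xs⊆ys₁++ys₂ : xs ⊆ ys₁ ++ ys₂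
  xs⊆ys₁++ys₂ y∈xs with ∈-++⁻ ys₁ (xs⊆ys (there y∈xs))
  ... | inj₁ y∈ys₁         = ∈-++⁺ˡ y∈ys₁
  ... | inj₂ (here refl)   = ⊥-elim (All.lookup x∉xs y∈xs refl)
  ... | inj₂ (there y∈ys₂) = ∈-++⁺ʳ ys₁ y∈ys₂

allFin-suc : ∀ m → allFin (suc m) ≡ zero ∷ map suc (allFin m)
allFin-suc m = cong (zero ∷_) (≡.sym (map-tabulate (λ i → i) suc))

module _ (G : Graph) (ℓ : Labeling G) where

  private
    range : List ℤ
    range = deduplicate ℤ._≟_ (map ℓ (allFin (k G)))

  length-≤-order : (vs : List (Fin (k G))) → Unique (map ℓ vs) → length (map ℓ vs) ≤ order G ℓ
  length-≤-order vs distinct = unique-⊆⇒length-≤ distinct labels⊆range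
    where
    labels⊆range : map ℓ vs ⊆ range
    labels⊆range x∈ with ∈-map⁻ ℓ x∈
    ... | v , _ , refl = ∈-deduplicate⁺ ℤ._≟_ (∈-map⁺ ℓ (∈-allFin v))

  order-≤-length : (xs : List ℤ) → (∀ v → ℓ v ∈ xs) → order G ℓ ≤ length xs
  order-≤-length xs ℓ∈xs = unique-⊆⇒length-≤ (deduplicate-! _) range⊆xs
    where
    range⊆xs : range ⊆ xs
    range⊆xs x∈ with ∈-map⁻ ℓ (∈-deduplicate⁻ ℤ._≟_ _ x∈)
    ... | v , _ , refl = ℓ∈xs v

  proper⇒2≤order : ∀ {v w} → Adj G v w → Proper G ℓ → 2 ≤ order G ℓ
  proper⇒2≤order {v} {w} v~w proper = length-≤-order (v ∷ w ∷ []) ((proper v w v~w ∷ []) ∷ [] ∷ [])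

inClosedNbhd? : (G : Graph) (v : Fin (k G)) → Decidable (λ w → v ≡ w ⊎ Adj G v w)
inClosedNbhd? G v w = (v Fin.≟ w) ⊎-dec adj? G v w

-- Both tests compare toℕ values with _≡ᵇ_, so they agree definitionally on suc w and w.
closedNbhd-shift : ∀ m (v : Fin m) →
  filter (inClosedNbhd? (PathGraph (suc m)) (suc v)) (map suc (allFin m)) ≡ map suc (closedNbhd (PathGraph m) v)
closedNbhd-shift m v =
  filter-map (inClosedNbhd? (PathGraph (suc m)) (suc v)) (inClosedNbhd? (PathGraph m) v) suc (λ _ → refl) (allFin m)

closedNbhd-suc-suc : ∀ m (v : Fin m) →
  closedNbhd (PathGraph (suc (suc m))) (suc (suc v)) ≡ map suc (closedNbhd (PathGraph (suc m)) (suc v))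
closedNbhd-suc-suc m v =
  trans (cong (filter (inClosedNbhd? (PathGraph (suc (suc m))) (suc (suc v)))) (allFin-suc (suc m)))
        (closedNbhd-shift (suc m) (suc v))

closedNbhd-suc-zero : ∀ m →
  closedNbhd (PathGraph (suc (suc m))) (suc zero) ≡ zero ∷ map suc (closedNbhd (PathGraph (suc m)) zero)
closedNbhd-suc-zero m =
  trans (cong (filter (inClosedNbhd? (PathGraph (suc (suc m))) (suc zero))) (allFin-suc (suc m)))
        (cong (zero ∷_) (closedNbhd-shift (suc m) zero))

closedNbhd-first : ∀ m → closedNbhd (PathGraph (suc (suc m))) zero ≡ zero ∷ suc zero ∷ []
closedNbhd-first m = cong (λ vs → zero ∷ suc zero ∷ vs)
  (filter-none (inClosedNbhd? (PathGraph (suc (suc m))) zero)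
               (tabulate⁺ {f = λ (w : Fin m) → suc (suc w)} λ _ → λ { (inj₁ ()) ; (inj₂ (inj₁ ())) ; (inj₂ (inj₂ ())) }))

closedNbhd-inner : ∀ m (v : Fin m) → closedNbhd (PathGraph (suc (suc m))) (suc (inject₁ v)) ≡
                   inject₁ (inject₁ v) ∷ suc (inject₁ v) ∷ suc (suc v) ∷ []
closedNbhd-inner (suc m) zero =
  trans (closedNbhd-suc-zero (suc m)) (cong (λ vs → zero ∷ map suc vs) (closedNbhd-first m))
closedNbhd-inner (suc m) (suc v) =
  trans (closedNbhd-suc-suc (suc m) (inject₁ v)) (cong (map suc) (closedNbhd-inner m v))

closedNbhd-last : ∀ m → closedNbhd (PathGraph (suc (suc m))) (fromℕ (suc m)) ≡ inject₁ (fromℕ m) ∷ fromℕ (suc m) ∷ []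
closedNbhd-last zero = refl
closedNbhd-last (suc m) = trans (closedNbhd-suc-suc (suc m) (fromℕ m)) (cong (map suc) (closedNbhd-last m))

module _ (m : ℕ) (ℓ : Labeling (PathGraph (suc (suc m)))) where

  private
    sumOver : List (Fin (suc (suc m))) → ℤ
    sumOver vs = foldr _+_ (+ 0) (map ℓ vs)

  closedSum-first : closedSum (PathGraph (suc (suc m))) ℓ zero ≡ ℓ zero + ℓ (suc zero)
  closedSum-first = trans (cong sumOver (closedNbhd-first m)) (cong (_+_ (ℓ zero)) (ℤ.+-identityʳ _))

  closedSum-inner : ∀ v → closedSum (PathGraph (suc (suc m))) ℓ (suc (inject₁ v)) ≡
                    ℓ (inject₁ (inject₁ v)) + (ℓ (suc (inject₁ v)) + ℓ (suc (suc v)))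
  closedSum-inner v = trans (cong sumOver (closedNbhd-inner m v))
                            (cong (λ x → ℓ (inject₁ (inject₁ v)) + (ℓ (suc (inject₁ v)) + x)) (ℤ.+-identityʳ _))

  closedSum-last : closedSum (PathGraph (suc (suc m))) ℓ (fromℕ (suc m)) ≡ ℓ (inject₁ (fromℕ m)) + ℓ (fromℕ (suc m))
  closedSum-last = trans (cong sumOver (closedNbhd-last m)) (cong (_+_ (ℓ (inject₁ (fromℕ m)))) (ℤ.+-identityʳ _))

data PathVertex (m : ℕ) : Fin (suc (suc m)) → Set where
  first : PathVertex m zero
  inner : (v : Fin m) → PathVertex m (suc (inject₁ v))
  last  : PathVertex m (fromℕ (suc m))

pathVertex : ∀ m (v : Fin (suc (suc m))) → PathVertex m v
pathVertex m zero = first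
pathVertex zero (suc zero) = last
pathVertex (suc m) (suc v) with pathVertex m v
... | first   = inner zero
... | inner u = inner (suc u)
... | last    = last

closedSum-path-cases : ∀ {P : ℤ → Set} m (f : ℕ → ℤ) →
  P (f 0 + f 1) →
  (∀ (v : Fin m) → let i = toℕ v in P (f i + (f (suc i) + f (suc (suc i))))) →
  P (f m + f (suc m)) →
  ∀ v → P (closedSum (PathGraph (suc (suc m))) (f ∘ toℕ) v)
closedSum-path-cases m f first-pair inner-triple last-pair v with pathVertex m v
... | first rewrite closedSum-first m (f ∘ toℕ) = first-pair
... | inner u rewrite closedSum-inner m (f ∘ toℕ) u | toℕ-inject₁ (inject₁ u) | toℕ-inject₁ u = inner-triple u
... | last rewrite closedSum-last m (f ∘ toℕ) | toℕ-inject₁ (fromℕ m) | toℕ-fromℕ m = last-pair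

proper-path : ∀ m (f : ℕ → ℤ) → (∀ i → f i ≢ f (suc i)) → Proper (PathGraph m) (f ∘ toℕ)
proper-path m f f≢ v w (inj₁ 1+v≡w) fv≡fw = f≢ (toℕ v) (trans fv≡fw (cong f (≡.sym 1+v≡w)))
proper-path m f f≢ v w (inj₂ 1+w≡v) fv≡fw = f≢ (toℕ w) (trans (≡.sym fv≡fw) (cong f (≡.sym 1+w≡v)))

2∤1 : ¬ (+ 2 ∣ + 1)
2∤1 = from-no (2 ℕ.∣? 1)

2∤3 : ¬ (+ 2 ∣ + 3)
2∤3 = from-no (2 ℕ.∣? 3)

2∣⊎2∣+1 : ∀ x → + 2 Signed.∣ x ⊎ + 2 Signed.∣ x + + 1
2∣⊎2∣+1 x with x %ℕ 2 | n%ℕd<d x 2 | a≡a%ℕn+[a/ℕn]*n x 2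
... | 0 | _ | x≡0+q*2 = inj₁ (Signed.divides (x /ℕ 2) (trans x≡0+q*2 (ℤ.+-identityˡ _)))
... | 1 | _ | x≡1+q*2 = inj₂ (Signed.divides (x /ℕ 2 + + 1) (trans (cong (_+ + 1) x≡1+q*2) (regroup (x /ℕ 2))))
  where
  regroup : ∀ q → (+ 1 + q * + 2) + + 1 ≡ (q + + 1) * + 2
  regroup = solve-∀
... | suc (suc _) | s≤s (s≤s ()) | _

odd+odd-even : ∀ {x y} → ¬ (+ 2 ∣ x) → ¬ (+ 2 ∣ y) → + 2 Signed.∣ x + y
odd+odd-even {x} {y} x-odd y-odd with 2∣⊎2∣+1 x | 2∣⊎2∣+1 y
... | inj₁ 2∣x | _ = ⊥-elim (x-odd (Signed.∣⇒∣ᵤ 2∣x))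
... | _ | inj₁ 2∣y = ⊥-elim (y-odd (Signed.∣⇒∣ᵤ 2∣y))
... | inj₂ 2∣x+1 | inj₂ 2∣y+1 =
  Signed.∣m+n∣n⇒∣m (subst (+ 2 Signed.∣_) (regroup x y) (Signed.∣m∣n⇒∣m+n 2∣x+1 2∣y+1)) Signed.∣-refl
  where
  regroup : ∀ x y → (x + + 1) + (y + + 1) ≡ (x + y) + + 2
  regroup = solve-∀

-- The three sums add up to 4 (a + b), so they cannot all be odd.
abab-closedSums-not-all-odd : ∀ a b →
  ¬ (+ 2 ∣ a + b) → ¬ (+ 2 ∣ a + (b + a)) → ¬ (+ 2 ∣ b + (a + b)) → ⊥
abab-closedSums-not-all-odd a b s₀-odd s₁-odd s₂-odd =
  s₂-odd (Signed.∣⇒∣ᵤ (Signed.∣m+n∣m⇒∣n 2∣total (odd+odd-even {a + b} {a + (b + a)} s₀-odd s₁-odd)))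
  where
  total≡ : ∀ a b → (a + b + (a + (b + a))) + (b + (a + b)) ≡ ((a + b) * + 2) * + 2
  total≡ = solve-∀
  2∣total : + 2 Signed.∣ (a + b + (a + (b + a))) + (b + (a + b))
  2∣total = Signed.divides ((a + b) * + 2) (total≡ a b)

mod2 : ℕ → ℤ
mod2 zero = + 0
mod2 (suc zero) = + 1
mod2 (suc (suc i)) = mod2 i

mod2-≢-suc : ∀ i → mod2 i ≢ mod2 (suc i)
mod2-≢-suc zero ()
mod2-≢-suc (suc zero) ()
mod2-≢-suc (suc (suc i)) = mod2-≢-suc i

mod2-range : ∀ i → mod2 i ∈ + 0 ∷ + 1 ∷ []
mod2-range zero = here refl
mod2-range (suc zero) = there (here refl)
mod2-range (suc (suc i)) = mod2-range i

mod2-pair : ∀ i → mod2 i + mod2 (suc i) ≡ + 1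
mod2-pair zero = refl
mod2-pair (suc zero) = refl
mod2-pair (suc (suc i)) = mod2-pair i

mod2-triple : ∀ i → let s = mod2 i + (mod2 (suc i) + mod2 (suc (suc i))) in s ≡ + 1 ⊎ s ≡ + 2
mod2-triple zero = inj₁ refl
mod2-triple (suc zero) = inj₂ refl
mod2-triple (suc (suc i)) = mod2-triple i

mod3 : ℕ → ℤ
mod3 zero = + 0
mod3 (suc zero) = + 1
mod3 (suc (suc zero)) = + 2
mod3 (suc (suc (suc i))) = mod3 i

mod3-≢-suc : ∀ i → mod3 i ≢ mod3 (suc i)
mod3-≢-suc zero ()
mod3-≢-suc (suc zero) ()
mod3-≢-suc (suc (suc zero)) ()
mod3-≢-suc (suc (suc (suc i))) = mod3-≢-suc i

mod3-range : ∀ i → mod3 i ∈ + 0 ∷ + 1 ∷ + 2 ∷ []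
mod3-range zero = here refl
mod3-range (suc zero) = there (here refl)
mod3-range (suc (suc zero)) = there (there (here refl))
mod3-range (suc (suc (suc i))) = mod3-range i

mod3-pair-odd : ∀ i → mod3 i ≢ + 2 → ¬ (+ 2 ∣ mod3 i + mod3 (suc i))
mod3-pair-odd zero _ = 2∤1
mod3-pair-odd (suc zero) _ = 2∤3
mod3-pair-odd (suc (suc zero)) ≢2 = ⊥-elim (≢2 refl)
mod3-pair-odd (suc (suc (suc i))) = mod3-pair-odd i

mod3-triple : ∀ i → mod3 i + (mod3 (suc i) + mod3 (suc (suc i))) ≡ + 3
mod3-triple zero = refl
mod3-triple (suc zero) = refl
mod3-triple (suc (suc zero)) = refl
mod3-triple (suc (suc (suc i))) = mod3-triple i

-- 1 exactly when m ≡ 2 (mod 3), so that the end pairs of P_(m+2), starting at 0 and at m,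
-- both avoid residue 2 once mod3 is shifted by it.
offset : ℕ → ℕ
offset zero = 0
offset (suc zero) = 0
offset (suc (suc zero)) = 1
offset (suc (suc (suc m))) = offset m

mod3-offset≢2 : ∀ m → mod3 (offset m) ≢ + 2
mod3-offset≢2 zero ()
mod3-offset≢2 (suc zero) ()
mod3-offset≢2 (suc (suc zero)) ()
mod3-offset≢2 (suc (suc (suc m))) = mod3-offset≢2 m

mod3-m+offset≢2 : ∀ m → mod3 (m ℕ.+ offset m) ≢ + 2
mod3-m+offset≢2 zero ()
mod3-m+offset≢2 (suc zero) ()
mod3-m+offset≢2 (suc (suc zero)) ()
mod3-m+offset≢2 (suc (suc (suc m))) = mod3-m+offset≢2 m

module _ (m : ℕ) where

  private
    P = PathGraph (suc (suc m))

  chi≡2 : ∀ {n} → (∀ v → ¬ (+ n ∣ closedSum P (mod2 ∘ toℕ) v)) → ChiIs n P 2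
  chi≡2 mod2-closed =
    (mod2 ∘ toℕ , (mod2-proper , mod2-closed) ,
     ≤-antisym (order-≤-length P (mod2 ∘ toℕ) _ (mod2-range ∘ toℕ)) (2≤order (mod2 ∘ toℕ) mod2-proper)) ,
    λ ℓ (proper , _) → 2≤order ℓ proper
    where
    mod2-proper : Proper P (mod2 ∘ toℕ)
    mod2-proper = proper-path _ mod2 mod2-≢-suc
    2≤order : ∀ ℓ → Proper P ℓ → 2 ≤ order P ℓ
    2≤order ℓ = proper⇒2≤order P ℓ {zero} {suc zero} (inj₁ refl)

  mod2-closedSum-∤ : ∀ {n} → n ≥ 3 → ∀ v → ¬ (+ n ∣ closedSum P (mod2 ∘ toℕ) v)
  mod2-closedSum-∤ {n} n≥3 = closedSum-path-cases {P = λ x → ¬ (+ n ∣ x)} m mod2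
    (∤ (inj₁ refl)) (λ v → ∤ (mod2-triple (toℕ v))) (∤ (inj₁ (mod2-pair m)))
    where
    ∤ : ∀ {x} → x ≡ + 1 ⊎ x ≡ + 2 → ¬ (+ n ∣ x)
    ∤ (inj₁ refl) = ℕ.>⇒∤ (≤-trans (s≤s (s≤s z≤n)) n≥3)
    ∤ (inj₂ refl) = ℕ.>⇒∤ n≥3

module _ (m : ℕ) where

  private
    P = PathGraph (suc (suc (suc (suc m))))
    v₀ v₁ v₂ v₃ : Fin (suc (suc (suc (suc m))))
    v₀ = zero
    v₁ = suc zero
    v₂ = suc (suc zero)
    v₃ = suc (suc (suc zero))

  3≤order : ∀ ℓ → ProperClosedColoringMod 2 P ℓ → 3 ≤ order P ℓ
  3≤order ℓ (proper , closed) with ℓ v₀ ℤ.≟ ℓ v₂ | ℓ v₁ ℤ.≟ ℓ v₃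
  ... | no ℓ₀≢ℓ₂ | _ = length-≤-order P ℓ (v₀ ∷ v₁ ∷ v₂ ∷ [])
        ((proper v₀ v₁ (inj₁ refl) ∷ ℓ₀≢ℓ₂ ∷ []) ∷ (proper v₁ v₂ (inj₁ refl) ∷ []) ∷ [] ∷ [])
  ... | yes _ | no ℓ₁≢ℓ₃ = length-≤-order P ℓ (v₁ ∷ v₂ ∷ v₃ ∷ [])
        ((proper v₁ v₂ (inj₁ refl) ∷ ℓ₁≢ℓ₃ ∷ []) ∷ (proper v₂ v₃ (inj₁ refl) ∷ []) ∷ [] ∷ [])
  ... | yes ℓ₀≡ℓ₂ | yes ℓ₁≡ℓ₃ = ⊥-elim (abab-closedSums-not-all-odd (ℓ v₀) (ℓ v₁) s₀-odd s₁-odd s₂-odd)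
    where
    odd : ∀ {x} v → closedSum P ℓ v ≡ x → ¬ (+ 2 ∣ x)
    odd v eq = subst (λ x → ¬ (+ 2 ∣ x)) eq (closed v)
    s₀-odd : ¬ (+ 2 ∣ ℓ v₀ + ℓ v₁)
    s₀-odd = odd v₀ (closedSum-first (suc (suc m)) ℓ)
    s₁-odd : ¬ (+ 2 ∣ ℓ v₀ + (ℓ v₁ + ℓ v₀))
    s₁-odd = odd v₁ (trans (closedSum-inner (suc (suc m)) ℓ zero) (cong (λ x → ℓ v₀ + (ℓ v₁ + x)) (≡.sym ℓ₀≡ℓ₂)))
    s₂-odd : ¬ (+ 2 ∣ ℓ v₁ + (ℓ v₀ + ℓ v₁))
    s₂-odd = odd v₂ (trans (closedSum-inner (suc (suc m)) ℓ (suc zero))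
                           (cong₂ (λ x y → ℓ v₁ + (x + y)) (≡.sym ℓ₀≡ℓ₂) (≡.sym ℓ₁≡ℓ₃)))

  mod3-shifted : ℕ → ℤ
  mod3-shifted i = mod3 (i ℕ.+ offset (suc (suc m)))

  mod3-shifted-closedSum-odd : ∀ v → ¬ (+ 2 ∣ closedSum P (mod3-shifted ∘ toℕ) v)
  mod3-shifted-closedSum-odd = closedSum-path-cases {P = λ x → ¬ (+ 2 ∣ x)} (suc (suc m)) mod3-shifted
    (mod3-pair-odd (offset (suc (suc m))) (mod3-offset≢2 (suc (suc m))))
    (λ v → subst (λ x → ¬ (+ 2 ∣ x)) (≡.sym (mod3-triple (toℕ v ℕ.+ offset (suc (suc m))))) 2∤3)
    (mod3-pair-odd (suc (suc m) ℕ.+ offset (suc (suc m))) (mod3-m+offset≢2 (suc (suc m))))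

  chi≡3 : ChiIs 2 P 3
  chi≡3 =
    (mod3-shifted ∘ toℕ , coloring ,
     ≤-antisym (order-≤-length P (mod3-shifted ∘ toℕ) _ (λ v → mod3-range (toℕ v ℕ.+ offset (suc (suc m)))))
               (3≤order (mod3-shifted ∘ toℕ) coloring)) ,
    3≤order
    where
    coloring : ProperClosedColoringMod 2 P (mod3-shifted ∘ toℕ)
    coloring = proper-path _ mod3-shifted (λ i → mod3-≢-suc (i ℕ.+ offset (suc (suc m)))) , mod3-shifted-closedSum-odd

theorem4p1 : (n m : ℕ) → n ≥ 2 → m ≥ 2 →
    ((n ≥ 3 ⊎ (n ≡ 2 × m ≤ 3)) → ChiIs n (PathGraph m) 2)
    × ((n ≡ 2 × m ≥ 4) → ChiIs n (PathGraph m) 3)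
theorem4p1 n (suc (suc m)) _ (s≤s (s≤s z≤n)) = two-labels , three-labels
  where
  two-labels : (n ≥ 3 ⊎ (n ≡ 2 × suc (suc m) ≤ 3)) → ChiIs n (PathGraph (suc (suc m))) 2
  two-labels (inj₁ n≥3) = chi≡2 m (mod2-closedSum-∤ m n≥3)
  two-labels (inj₂ (refl , s≤s (s≤s z≤n))) = chi≡2 0 λ { zero → 2∤1 ; (suc zero) → 2∤1 }
  two-labels (inj₂ (refl , s≤s (s≤s (s≤s z≤n)))) =
    chi≡2 1 λ { zero → 2∤1 ; (suc zero) → 2∤1 ; (suc (suc zero)) → 2∤1 }
  three-labels : (n ≡ 2 × suc (suc m) ≥ 4) → ChiIs n (PathGraph (suc (suc m))) 3
  three-labels (refl , s≤s (s≤s (s≤s (s≤s _)))) = chi≡3 _
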